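{- Let $\mathcal{T}\subseteq\mathscr{P}(X)$ be a $*$-lower semi-lattice over a countable set $X$, and let $g$ be a coherent subsystem of $\mathcal{T}$. Then the pair of families $\mathcal{C}(\mathcal{T},g)=(\{g(A):A\in\mathcal{T}\},\{A\setminus g(A):A\in\mathcal{T}\})$ is a pregap, i.e. $g(A)\cap(B\setminus g(B))=^*\emptyset$ for all $A,B\in\mathcal{T}$. Moreover, $g$ is non-trivial if and only if $\mathcal{C}(\mathcal{T},g)$ is a gap, i.e. there is no $C\subseteq X$ with $g(A)\subseteq^*C$ and $C\cap(A\setminus g(A))=^*\emptyset$ for all $A\in\mathcal{T}$.
   Context: $A\subseteq^*B$ means $A\setminus B$ is finite; $A=^*B$ means $A\triangle B$ is finite. A family $\mathcal{T}\subseteq\mathscr{P}(X)$ is a $*$-lower semi-lattice if for any $A,B\in\mathcal{T}$ there is $C\in\mathcal{T}$ with $A\cap B=^*C$. A coherent subsystem of $\mathcal{T}$ is a function $g:\mathcal{T}\to\mathscr{P}(X)$ such that for all $A,B\in\mathcal{T}$: (1) $g(A)\subseteq A$; (2) if $B\subseteq^*A$ then $g(A)\cap B=^*g(B)$. It is trivial if there is $C\subseteq X$ with $C\cap A=^*g(A)$ for every $A\in\mathcal{T}$. -}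

module Defs where

open import Data.Bool using (Bool; true; false; _∧_; _xor_; not)
open import Data.Nat using (ℕ)
open import Data.List using (List)
open import Data.List.Membership.Propositional using (_∈_)
open import Data.Product using (Σ; ∃; _×_)
open import Relation.Binary.PropositionalEquality using (_≡_)
open import Relation.Nullary using (¬_)
open import Function.Definitions using (Injective)

Countable : Set → Set
Countable X = Σ (X → ℕ) (λ f → Injective _≡_ _≡_ f)

Subset : Set → Set
Subset X = X → Bool

module _ {X : Set} where

  _∈ₛ_ : X → Subset X → Set
  x ∈ₛ A = A x ≡ true

  ∅ : Subset X
  ∅ _ = false

  _∩_ : Subset X → Subset X → Subset X
  (A ∩ B) x = A x ∧ B x

  _∖_ : Subset X → Subset X → Subset X
  (A ∖ B) x = A x ∧ not (B x)

  _△_ : Subset X → Subset X → Subset X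
  (A △ B) x = A x xor B x

  _⊆_ : Subset X → Subset X → Set
  A ⊆ B = ∀ x → x ∈ₛ A → x ∈ₛ B

  Finite : Subset X → Set
  Finite A = ∃ λ (L : List X) → ∀ x → x ∈ₛ A → x ∈ L

  _⊆*_ : Subset X → Subset X → Set
  A ⊆* B = Finite (A ∖ B)

  _=*_ : Subset X → Subset X → Set
  A =* B = Finite (A △ B)

  Family : Set₁
  Family = Subset X → Set

  IsStarLowerSemiLattice : Family → Set
  IsStarLowerSemiLattice 𝒯 =
    ∀ A B → 𝒯 A → 𝒯 B → ∃ λ C → 𝒯 C × ((A ∩ B) =* C)

  -- g : 𝒯 → 𝒫(X); only its values on members of 𝒯 matter.
  IsCoherentSubsystem : Family → (Subset X → Subset X) → Set
  IsCoherentSubsystem 𝒯 g =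
    (∀ A → 𝒯 A → g A ⊆ A) ×
    (∀ A B → 𝒯 A → 𝒯 B → B ⊆* A → (g A ∩ B) =* g B)

  IsTrivial : Family → (Subset X → Subset X) → Set
  IsTrivial 𝒯 g = ∃ λ C → ∀ A → 𝒯 A → (C ∩ A) =* g A

  IsPregap : Family → (Subset X → Subset X) → Set
  IsPregap 𝒯 g = ∀ A B → 𝒯 A → 𝒯 B → (g A ∩ (B ∖ g B)) =* ∅

  Separates : Family → (Subset X → Subset X) → Subset X → Set
  Separates 𝒯 g C = ∀ A → 𝒯 A → (g A ⊆* C) × ((C ∩ (A ∖ g A)) =* ∅)

  IsGap : Family → (Subset X → Subset X) → Set
  IsGap 𝒯 g = IsPregap 𝒯 g × ¬ (∃ λ C → Separates 𝒯 g C)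

-- Given A, B ∈ 𝒯, pick C ∈ 𝒯 with C =* A ∩ B; then C ⊆* A and C ⊆* B, so by
-- coherence g(A) and g(B) agree with g(C) on C. A point of g(A) ∩ (B ∖ g(B)) is
-- either outside C, hence in (A ∩ B) △ C, or inside C, where it witnesses a
-- disagreement of g(A) or g(B) with g(C); only finitely many points do either.
-- For the equivalence, since g(A) ⊆ A, a set C separates the pregap exactly when
-- C ∩ A =* g(A) for every A ∈ 𝒯, i.e. when C witnesses triviality.
module Submission where

open import Defs
open import Data.Bool using (true; false; _∧_; _∨_; _xor_; not)
open import Data.List using (_++_)
open import Data.List.Membership.Propositional using (_∈_)
open import Data.List.Membership.Propositional.Properties using (∈-++⁺ˡ; ∈-++⁺ʳ)
open import Data.Product using (_×_; _,_; proj₁; proj₂; ∃)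
open import Function.Bundles using (_⇔_; mk⇔)
open import Relation.Binary.PropositionalEquality using (_≡_; refl)
open import Relation.Nullary using (¬_)

module _ {X : Set} where

  _∪_ : Subset X → Subset X → Subset X
  (A ∪ B) x = A x ∨ B x

  finite-mono : {A B : Subset X} → A ⊆ B → Finite B → Finite A
  finite-mono A⊆B (L , B⊆L) = L , λ x x∈A → B⊆L x (A⊆B x x∈A)

  finite-∪ : {A B : Subset X} → Finite A → Finite B → Finite (A ∪ B)
  finite-∪ {A} {B} (L , A⊆L) (M , B⊆M) = L ++ M , λ x → ∈-∪ x (A x) (B x) refl refl
    where
    ∈-∪ : ∀ x a b → A x ≡ a → B x ≡ b → a ∨ b ≡ true → x ∈ (L ++ M)
    ∈-∪ x true  b     x∈A _   _ = ∈-++⁺ˡ (A⊆L x x∈A)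
    ∈-∪ x false true  _   x∈B _ = ∈-++⁺ʳ L (B⊆M x x∈B)

  =*-∩⇒⊆*ˡ : {A B C : Subset X} → (A ∩ B) =* C → C ⊆* A
  =*-∩⇒⊆*ˡ {A} {B} {C} = finite-mono λ x → pointwise (A x) (B x) (C x)
    where
    pointwise : ∀ a b c → c ∧ not a ≡ true → (a ∧ b) xor c ≡ true
    pointwise false _ true _ = refl

  =*-∩⇒⊆*ʳ : {A B C : Subset X} → (A ∩ B) =* C → C ⊆* B
  =*-∩⇒⊆*ʳ {A} {B} {C} = finite-mono λ x → pointwise (A x) (B x) (C x)
    where
    pointwise : ∀ a b c → c ∧ not b ≡ true → (a ∧ b) xor c ≡ true
    pointwise false false true _ = refl
    pointwise true  false true _ = refl

  coherent⇒pregap : (𝒯 : Family) (g : Subset X → Subset X) →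
    IsStarLowerSemiLattice 𝒯 → IsCoherentSubsystem 𝒯 g → IsPregap 𝒯 g
  coherent⇒pregap 𝒯 g lattice (g⊆ , coherent) A B 𝒯A 𝒯B =
    finite-mono cover
      (finite-∪ A∩B=*C (finite-∪ (coherent A C 𝒯A 𝒯C (=*-∩⇒⊆*ˡ {A} A∩B=*C))
                                 (coherent B C 𝒯B 𝒯C (=*-∩⇒⊆*ʳ {A} A∩B=*C))))
    where
    C : Subset X
    C = proj₁ (lattice A B 𝒯A 𝒯B)

    𝒯C : 𝒯 C
    𝒯C = proj₁ (proj₂ (lattice A B 𝒯A 𝒯B))

    A∩B=*C : (A ∩ B) =* C
    A∩B=*C = proj₂ (proj₂ (lattice A B 𝒯A 𝒯B))

    pointwise : ∀ ga a b gb c gc → (ga ≡ true → a ≡ true) → (ga ∧ (b ∧ not gb)) xor false ≡ true →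
      ((a ∧ b) xor c) ∨ (((ga ∧ c) xor gc) ∨ ((gb ∧ c) xor gc)) ≡ true
    pointwise true a true false c gc ga⇒a _ with ga⇒a refl
    pointwise true .true true false false _     _ _ | refl = refl
    pointwise true .true true false true  false _ _ | refl = refl
    pointwise true .true true false true  true  _ _ | refl = refl

    cover : ((g A ∩ (B ∖ g B)) △ ∅) ⊆
      (((A ∩ B) △ C) ∪ (((g A ∩ C) △ g C) ∪ ((g B ∩ C) △ g C)))
    cover x = pointwise (g A x) (A x) (B x) (g B x) (C x) (g C x) (g⊆ A 𝒯A x)

  trivial⇒separated : (𝒯 : Family) (g : Subset X → Subset X) →
    IsTrivial 𝒯 g → ∃ λ C → Separates 𝒯 g C
  trivial⇒separated 𝒯 g (C , C∩=*g) = C , λ A 𝒯A →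
    finite-mono (λ x → outside (C x) (A x) (g A x)) (C∩=*g A 𝒯A) ,
    finite-mono (λ x → inside (C x) (A x) (g A x)) (C∩=*g A 𝒯A)
    where
    outside : ∀ c a ga → ga ∧ not c ≡ true → (c ∧ a) xor ga ≡ true
    outside false _ true _ = refl

    inside : ∀ c a ga → (c ∧ (a ∧ not ga)) xor false ≡ true → (c ∧ a) xor ga ≡ true
    inside true true false _ = refl

  separated⇒trivial : (𝒯 : Family) (g : Subset X → Subset X) → (∀ A → 𝒯 A → g A ⊆ A) →
    (∃ λ C → Separates 𝒯 g C) → IsTrivial 𝒯 g
  separated⇒trivial 𝒯 g g⊆ (C , separates) = C , λ A 𝒯A →
    finite-mono (λ x → pointwise (C x) (A x) (g A x) (g⊆ A 𝒯A x))
      (finite-∪ (proj₁ (separates A 𝒯A)) (proj₂ (separates A 𝒯A)))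
    where
    pointwise : ∀ c a ga → (ga ≡ true → a ≡ true) → (c ∧ a) xor ga ≡ true →
      (ga ∧ not c) ∨ ((c ∧ (a ∧ not ga)) xor false) ≡ true
    pointwise false _     true  _    _ = refl
    pointwise true  true  false _    _ = refl
    pointwise true  false true  ga⇒a _ with ga⇒a refl
    ... | ()

mainTheorem6 : {X : Set} → Countable X → (𝒯 : Family {X}) → (g : Subset X → Subset X) →
    IsStarLowerSemiLattice 𝒯 → IsCoherentSubsystem 𝒯 g →
    IsPregap 𝒯 g × ((¬ IsTrivial 𝒯 g) ⇔ IsGap 𝒯 g)
mainTheorem6 _ 𝒯 g lattice coherent =
  pregap ,
  mk⇔ (λ nonTrivial → pregap , λ separated →
        nonTrivial (separated⇒trivial 𝒯 g (proj₁ coherent) separated))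
      (λ gap trivial → proj₂ gap (trivial⇒separated 𝒯 g trivial))
  where
  pregap : IsPregap 𝒯 g
  pregap = coherent⇒pregap 𝒯 g lattice coherent
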